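{- The rule $(\forall_{r2})$ is invertible in $\mathsf{LNIF}$: if $\mathcal{G}/\!/\Gamma_1\vdash\Delta_1,\forall xA/\!/\Gamma_2\vdash\Delta_2/\!/\mathcal{H}$ is derivable in $\mathsf{LNIF}$ and $a$ is a parameter not occurring in it, then both $\mathcal{G}/\!/\Gamma_1\vdash\Delta_1/\!/\ \vdash A[a/x]/\!/\Gamma_2\vdash\Delta_2/\!/\mathcal{H}$ and $\mathcal{G}/\!/\Gamma_1\vdash\Delta_1/\!/\Gamma_2\vdash\Delta_2,\forall xA/\!/\mathcal{H}$ are derivable in $\mathsf{LNIF}$.
   Context: Formulae are first-order over $\bot,\land,\lor,\supset,\forall,\exists$; in sequents bound variables $x,y,\dots$ are distinct from parameters $a,b,\dots$, which occupy all free positions; $A[a/x]$ replaces free occurrences of $x$ by $a$; $p(\vec a)$ is an atomic formula with parameters $\vec a$. A linear nested sequent is $\Gamma_1\vdash\Delta_1 /\!/ \cdots /\!/ \Gamma_n\vdash\Delta_n$ ($n\ge1$), each $\Gamma_i,\Delta_i$ a finite, possibly empty, multiset of formulae (a component). In rule schemas, $\mathcal{G},\mathcal{H},\mathcal{F}$ denote possibly empty sequences of components. $\mathsf{LNIF}$ has the rules (from premise(s) infer conclusion): Initial: $(id_1)$ $\mathcal{G}/\!/\Gamma,p(\vec a)\vdash p(\vec a),\Delta/\!/\mathcal{H}$; $(id_2)$ $\mathcal{G}/\!/\Gamma_1,p(\vec a)\vdash\Delta_1/\!/\mathcal{H}/\!/\Gamma_2\vdash p(\vec a),\Delta_2/\!/\mathcal{F}$;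 $(\bot_l)$ $\mathcal{G}/\!/\Gamma,\bot\vdash\Delta/\!/\mathcal{H}$. $(\land_l)$: from $\mathcal{G}/\!/\Gamma,A,B\vdash\Delta/\!/\mathcal{H}$ infer $\mathcal{G}/\!/\Gamma,A\land B\vdash\Delta/\!/\mathcal{H}$. $(\lor_r)$: from $\mathcal{G}/\!/\Gamma\vdash\Delta,A,B/\!/\mathcal{H}$ infer $\mathcal{G}/\!/\Gamma\vdash\Delta,A\lor B/\!/\mathcal{H}$. $(\land_r)$: from $\mathcal{G}/\!/\Gamma\vdash\Delta,A/\!/\mathcal{H}$ and $\mathcal{G}/\!/\Gamma\vdash\Delta,B/\!/\mathcal{H}$ infer $\mathcal{G}/\!/\Gamma\vdash\Delta,A\land B/\!/\mathcal{H}$. $(\lor_l)$: from $\mathcal{G}/\!/\Gamma,A\vdash\Delta/\!/\mathcal{H}$ and $\mathcal{G}/\!/\Gamma,B\vdash\Delta/\!/\mathcal{H}$ infer $\mathcal{G}/\!/\Gamma,A\lor B\vdash\Delta/\!/\mathcal{H}$. $(\supset_{r1})$: from $\mathcal{G}/\!/\Gamma\vdash\Delta/\!/A\vdash B$ infer $\mathcal{G}/\!/\Gamma\vdash\Delta,A\supset B$. $(\supset_l)$: from $\mathcal{G}/\!/\Gamma,B\vdash\Delta/\!/\mathcal{H}$ and $\mathcal{G}/\!/\Gamma,A\supset B\vdash A,\Delta/\!/\mathcal{H}$ infer $\mathcal{G}/\!/\Gamma,A\supset B\vdash\Delta/\!/\mathcal{H}$. $(lift)$: from $\mathcal{G}/\!/\Gamma_1,A\vdash\Delta_1/\!/\Gamma_2,A\vdash\Delta_2/\!/\mathcal{H}$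 infer $\mathcal{G}/\!/\Gamma_1,A\vdash\Delta_1/\!/\Gamma_2\vdash\Delta_2/\!/\mathcal{H}$. $(\forall_l)$: from $\mathcal{G}/\!/\Gamma,A[a/x],\forall xA\vdash\Delta/\!/\mathcal{H}$ infer $\mathcal{G}/\!/\Gamma,\forall xA\vdash\Delta/\!/\mathcal{H}$ ($a$ any parameter). $(\forall_{r1})$: from $\mathcal{G}/\!/\Gamma\vdash\Delta/\!/\ \vdash A[a/x]$ infer $\mathcal{G}/\!/\Gamma\vdash\Delta,\forall xA$. $(\exists_l)$: from $\mathcal{G}/\!/\Gamma,A[a/x]\vdash\Delta/\!/\mathcal{H}$ infer $\mathcal{G}/\!/\Gamma,\exists xA\vdash\Delta/\!/\mathcal{H}$. $(\exists_r)$: from $\mathcal{G}/\!/\Gamma\vdash A[a/x],\exists xA,\Delta/\!/\mathcal{H}$ infer $\mathcal{G}/\!/\Gamma\vdash\exists xA,\Delta/\!/\mathcal{H}$ ($a$ any parameter). $(\supset_{r2})$: from $\mathcal{G}/\!/\Gamma_1\vdash\Delta_1/\!/A\vdash B/\!/\Gamma_2\vdash\Delta_2/\!/\mathcal{H}$ and $\mathcal{G}/\!/\Gamma_1\vdash\Delta_1/\!/\Gamma_2\vdash\Delta_2,A\supset B/\!/\mathcal{H}$ infer $\mathcal{G}/\!/\Gamma_1\vdash\Delta_1,A\supset B/\!/\Gamma_2\vdash\Delta_2/\!/\mathcal{H}$. $(\forall_{r2})$: from $\mathcal{G}/\!/\Gamma_1\vdash\Delta_1/\!/\ \vdash A[a/x]/\!/\Gamma_2\vdash\Delta_2/\!/\mathcal{H}$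 and $\mathcal{G}/\!/\Gamma_1\vdash\Delta_1/\!/\Gamma_2\vdash\Delta_2,\forall xA/\!/\mathcal{H}$ infer $\mathcal{G}/\!/\Gamma_1\vdash\Delta_1,\forall xA/\!/\Gamma_2\vdash\Delta_2/\!/\mathcal{H}$. In $(\forall_{r1}),(\exists_l),(\forall_{r2})$, $a$ is an eigenvariable (does not occur in the conclusion). -}

module Defs where

open import Data.Nat using (ℕ; _≟_)
open import Data.List using (List; []; _∷_; _++_; [_]; map; concatMap)
open import Data.List.Membership.Propositional using (_∈_)
open import Data.List.Relation.Binary.Permutation.Propositional using (_↭_)
open import Data.List.Relation.Binary.Pointwise using (Pointwise)
open import Relation.Nullary using (¬_; yes; no)
open import Data.Product using (_×_)

-- Bound variables and parameters are two disjoint sorts, both named by ℕ.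
Var : Set
Var = ℕ

Par : Set
Par = ℕ

data Term : Set where
  var : Var → Term
  par : Par → Term

data Formula : Set where
  ⊥′   : Formula
  atom : ℕ → List Term → Formula
  _∧′_ : Formula → Formula → Formula
  _∨′_ : Formula → Formula → Formula
  _⊃_  : Formula → Formula → Formula
  ∀′   : Var → Formula → Formula
  ∃′   : Var → Formula → Formula

substT : Var → Par → Term → Term
substT x a (var y) with x ≟ y
... | yes _ = par a
... | no  _ = var y
substT x a (par b) = par b

subst : Var → Par → Formula → Formula
subst x a ⊥′         = ⊥′
subst x a (atom p ts) = atom p (map (substT x a) ts)
subst x a (A ∧′ B)   = subst x a A ∧′ subst x a B
subst x a (A ∨′ B)   = subst x a A ∨′ subst x a B
subst x a (A ⊃ B)    = subst x a A ⊃ subst x a B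
subst x a (∀′ y A) with x ≟ y
... | yes _ = ∀′ y A
... | no  _ = ∀′ y (subst x a A)
subst x a (∃′ y A) with x ≟ y
... | yes _ = ∃′ y A
... | no  _ = ∃′ y (subst x a A)

_[_/_] : Formula → Par → Var → Formula
A [ a / x ] = subst x a A

parsT : Term → List Par
parsT (var _) = []
parsT (par a) = a ∷ []

parsF : Formula → List Par
parsF ⊥′          = []
parsF (atom p ts) = concatMap parsT ts
parsF (A ∧′ B)    = parsF A ++ parsF B
parsF (A ∨′ B)    = parsF A ++ parsF B
parsF (A ⊃ B)     = parsF A ++ parsF B
parsF (∀′ _ A)    = parsF A
parsF (∃′ _ A)    = parsF A

-- A component Γ ⊢ Δ; multisets are represented by lists, identified up to
-- permutation via the exchange rule `perm` below.
record Component : Set where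
  constructor _⊢_
  field
    ant : List Formula
    suc : List Formula
infix 4 _⊢_

-- A linear nested sequent Γ₁ ⊢ Δ₁ // ... // Γₙ ⊢ Δₙ (n ≥ 1 for the sequents
-- actually occurring; every rule conclusion below is non-empty).
LNS : Set
LNS = List Component

parsC : Component → List Par
parsC (Γ ⊢ Δ) = concatMap parsF Γ ++ concatMap parsF Δ

parsL : LNS → List Par
parsL = concatMap parsC

Fresh : Par → LNS → Set
Fresh a S = ¬ (a ∈ parsL S)

_≈C_ : Component → Component → Set
(Γ ⊢ Δ) ≈C (Γ′ ⊢ Δ′) = (Γ ↭ Γ′) × (Δ ↭ Δ′)


_≈L_ : LNS → LNS → Set
_≈L_ = Pointwise _≈C_

data LNIF : LNS → Set where
  perm  : ∀ {S S′} → S ≈L S′ → LNIF S → LNIF S′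
  id₁   : ∀ G H Γ Δ p ts →
          LNIF (G ++ ((atom p ts ∷ Γ ⊢ atom p ts ∷ Δ) ∷ H))
  id₂   : ∀ G H F Γ₁ Δ₁ Γ₂ Δ₂ p ts →
          LNIF (G ++ ((atom p ts ∷ Γ₁ ⊢ Δ₁) ∷ H ++ ((Γ₂ ⊢ atom p ts ∷ Δ₂) ∷ F)))
  ⊥l    : ∀ G H Γ Δ → LNIF (G ++ ((⊥′ ∷ Γ ⊢ Δ) ∷ H))
  ∧l    : ∀ {G H Γ Δ A B} →
          LNIF (G ++ ((A ∷ B ∷ Γ ⊢ Δ) ∷ H)) →
          LNIF (G ++ ((A ∧′ B ∷ Γ ⊢ Δ) ∷ H))
  ∨r    : ∀ {G H Γ Δ A B} →
          LNIF (G ++ ((Γ ⊢ A ∷ B ∷ Δ) ∷ H)) →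
          LNIF (G ++ ((Γ ⊢ A ∨′ B ∷ Δ) ∷ H))
  ∧r    : ∀ {G H Γ Δ A B} →
          LNIF (G ++ ((Γ ⊢ A ∷ Δ) ∷ H)) →
          LNIF (G ++ ((Γ ⊢ B ∷ Δ) ∷ H)) →
          LNIF (G ++ ((Γ ⊢ A ∧′ B ∷ Δ) ∷ H))
  ∨l    : ∀ {G H Γ Δ A B} →
          LNIF (G ++ ((A ∷ Γ ⊢ Δ) ∷ H)) →
          LNIF (G ++ ((B ∷ Γ ⊢ Δ) ∷ H)) →
          LNIF (G ++ ((A ∨′ B ∷ Γ ⊢ Δ) ∷ H))
  ⊃r₁   : ∀ {G Γ Δ A B} →
          LNIF (G ++ ((Γ ⊢ Δ) ∷ (A ∷ [] ⊢ B ∷ []) ∷ [])) →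
          LNIF (G ++ ((Γ ⊢ (A ⊃ B) ∷ Δ) ∷ []))
  ⊃l    : ∀ {G H Γ Δ A B} →
          LNIF (G ++ ((B ∷ Γ ⊢ Δ) ∷ H)) →
          LNIF (G ++ (((A ⊃ B) ∷ Γ ⊢ A ∷ Δ) ∷ H)) →
          LNIF (G ++ (((A ⊃ B) ∷ Γ ⊢ Δ) ∷ H))
  lift  : ∀ {G H Γ₁ Δ₁ Γ₂ Δ₂ A} →
          LNIF (G ++ ((A ∷ Γ₁ ⊢ Δ₁) ∷ (A ∷ Γ₂ ⊢ Δ₂) ∷ H)) →
          LNIF (G ++ ((A ∷ Γ₁ ⊢ Δ₁) ∷ (Γ₂ ⊢ Δ₂) ∷ H))
  ∀l    : ∀ {G H Γ Δ x A} (a : Par) →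
          LNIF (G ++ ((A [ a / x ] ∷ ∀′ x A ∷ Γ ⊢ Δ) ∷ H)) →
          LNIF (G ++ ((∀′ x A ∷ Γ ⊢ Δ) ∷ H))
  ∀r₁   : ∀ {G Γ Δ x A} (a : Par) →
          Fresh a (G ++ ((Γ ⊢ ∀′ x A ∷ Δ) ∷ [])) →
          LNIF (G ++ ((Γ ⊢ Δ) ∷ ([] ⊢ A [ a / x ] ∷ []) ∷ [])) →
          LNIF (G ++ ((Γ ⊢ ∀′ x A ∷ Δ) ∷ []))
  ∃l    : ∀ {G H Γ Δ x A} (a : Par) →
          Fresh a (G ++ ((∃′ x A ∷ Γ ⊢ Δ) ∷ H)) →
          LNIF (G ++ ((A [ a / x ] ∷ Γ ⊢ Δ) ∷ H)) →
          LNIF (G ++ ((∃′ x A ∷ Γ ⊢ Δ) ∷ H))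
  ∃r    : ∀ {G H Γ Δ x A} (a : Par) →
          LNIF (G ++ ((Γ ⊢ A [ a / x ] ∷ ∃′ x A ∷ Δ) ∷ H)) →
          LNIF (G ++ ((Γ ⊢ ∃′ x A ∷ Δ) ∷ H))
  ⊃r₂   : ∀ {G H Γ₁ Δ₁ Γ₂ Δ₂ A B} →
          LNIF (G ++ ((Γ₁ ⊢ Δ₁) ∷ (A ∷ [] ⊢ B ∷ []) ∷ (Γ₂ ⊢ Δ₂) ∷ H)) →
          LNIF (G ++ ((Γ₁ ⊢ Δ₁) ∷ (Γ₂ ⊢ (A ⊃ B) ∷ Δ₂) ∷ H)) →
          LNIF (G ++ ((Γ₁ ⊢ (A ⊃ B) ∷ Δ₁) ∷ (Γ₂ ⊢ Δ₂) ∷ H))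
  ∀r₂   : ∀ {G H Γ₁ Δ₁ Γ₂ Δ₂ x A} (a : Par) →
          Fresh a (G ++ ((Γ₁ ⊢ ∀′ x A ∷ Δ₁) ∷ (Γ₂ ⊢ Δ₂) ∷ H)) →
          LNIF (G ++ ((Γ₁ ⊢ Δ₁) ∷ ([] ⊢ A [ a / x ] ∷ []) ∷ (Γ₂ ⊢ Δ₂) ∷ H)) →
          LNIF (G ++ ((Γ₁ ⊢ Δ₁) ∷ (Γ₂ ⊢ ∀′ x A ∷ Δ₂) ∷ H)) →
          LNIF (G ++ ((Γ₁ ⊢ ∀′ x A ∷ Δ₁) ∷ (Γ₂ ⊢ Δ₂) ∷ H))

module Submission where

-- Derivability in LNIF is invariant under transposing two parameters, so clashes with
-- eigenvariables can always be renamed away. Both conclusions arise from the premise by one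
-- operation: take the occurrence of ∀xA out of its succedent and give it back further right,
-- either as ∀xA in a later succedent or as a new component ⊢ A[a/x] inserted to the right of
-- its component. By induction on derivations, every such transform of a derivable sequent (allowing
-- also weakening of antecedents, which lift needs to reach an inserted component) is derivable.
-- A rule not acting on the occurrence is applied again to the transformed premises, twice when
-- a component is inserted between its two active components. If the last rule is the ∀r
-- introducing the occurrence, its premise with eigenvariable b becomes the target by
-- transposing a and b; if ∀xA is given back further right, the second premise of ∀r₂, which
-- already holds ∀xA one component further, is transformed instead.

open import Defs
open import Data.Nat using (ℕ; suc; _≤_; _≟_; z≤n; s≤s)
open import Data.Nat.Properties using (≤-refl; ≤-trans; m≤m+n; m≤n+m; n≮n)
open import Data.Nat.ListAction using (sum)
open import Data.List using (List; []; _∷_; _++_; map; concatMap)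
open import Data.List.Properties using (map-++; map-∘; map-cong; map-id; map-id-local; ++-assoc; ++-identityʳ; concatMap-map)
open import Data.List.Membership.Propositional using (_∈_; _∉_)
open import Data.List.Membership.Propositional.Properties using (∈-map⁻; ∈-∃++; ∈-++⁺ˡ; ∈-++⁺ʳ)
open import Data.List.Relation.Unary.Any using (here; there)
open import Data.List.Relation.Unary.All using (All; []; _∷_)
import Data.List.Relation.Unary.All as All
open import Data.List.Relation.Unary.All.Properties using (¬Any⇒All¬; All¬⇒¬Any; ++⁺; ++⁻; ++⁻ˡ; ++⁻ʳ; concat⁺; concat⁻; map⁺; map⁻)
open import Data.List.Relation.Binary.Permutation.Propositional using (_↭_; ↭-refl; ↭-sym; ↭-trans; ↭-reflexive; prep; swap)
import Data.List.Relation.Binary.Permutation.Propositional.Properties as ↭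
open import Data.List.Relation.Binary.Pointwise using ([]; _∷_)
import Data.List.Relation.Binary.Pointwise as Pointwise
open import Relation.Binary.PropositionalEquality using (_≡_; _≢_; refl; sym; trans; cong; cong₂; module ≡-Reasoning) renaming (subst to cast)
open import Relation.Nullary using (yes; no)
open import Function using (_∘_; id)
open import Function.Definitions using (Injective)
open import Data.Empty using (⊥-elim)
open import Data.Product using (_×_; _,_; ∃)
open import Data.Sum using (_⊎_; inj₁; inj₂)

All-concatMap⁻ : ∀ {X Y : Set} {P : Y → Set} {f : X → List Y} xs → All P (concatMap f xs) → All (All P ∘ f) xs
All-concatMap⁻ xs = map⁻ ∘ concat⁻

All-concatMap⁺ : ∀ {X Y : Set} {P : Y → Set} {f : X → List Y} {xs} → All (All P ∘ f) xs → All P (concatMap f xs)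
All-concatMap⁺ = concat⁺ ∘ map⁺

≈L-refl : ∀ S → S ≈L S
≈L-refl S = Pointwise.refl (λ { {_ ⊢ _} → ↭-refl , ↭-refl })

≈L-at : ∀ G H {Γ Δ Γ′ Δ′} → Γ ↭ Γ′ → Δ ↭ Δ′ → (G ++ (Γ ⊢ Δ) ∷ H) ≈L (G ++ (Γ′ ⊢ Δ′) ∷ H)
≈L-at G H Γ↭ Δ↭ = Pointwise.++⁺ (≈L-refl G) ((Γ↭ , Δ↭) ∷ ≈L-refl H)

perm-at : ∀ G H {Γ Δ Γ′ Δ′} → Γ ↭ Γ′ → Δ ↭ Δ′ → LNIF (G ++ (Γ ⊢ Δ) ∷ H) → LNIF (G ++ (Γ′ ⊢ Δ′) ∷ H)
perm-at G H Γ↭ Δ↭ = perm (≈L-at G H Γ↭ Δ↭)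

regroup : ∀ (P : LNS → Set) T₁ C X → P (T₁ ++ C ∷ X) → P ((T₁ ++ C ∷ []) ++ X)
regroup P T₁ C X = cast P (sym (++-assoc T₁ (C ∷ []) X))

ungroup : ∀ T₁ C X → LNIF ((T₁ ++ C ∷ []) ++ X) → LNIF (T₁ ++ C ∷ X)
ungroup T₁ C X = cast LNIF (++-assoc T₁ (C ∷ []) X)

-- Renaming parameters

renT : (Par → Par) → Term → Term
renT ρ (var y) = var y
renT ρ (par b) = par (ρ b)

renF : (Par → Par) → Formula → Formula
renF ρ ⊥′          = ⊥′
renF ρ (atom p ts) = atom p (map (renT ρ) ts)
renF ρ (A ∧′ B)    = renF ρ A ∧′ renF ρ B
renF ρ (A ∨′ B)    = renF ρ A ∨′ renF ρ B
renF ρ (A ⊃ B)     = renF ρ A ⊃ renF ρ B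
renF ρ (∀′ y A)    = ∀′ y (renF ρ A)
renF ρ (∃′ y A)    = ∃′ y (renF ρ A)

renC : (Par → Par) → Component → Component
renC ρ (Γ ⊢ Δ) = map (renF ρ) Γ ⊢ map (renF ρ) Δ

renL : (Par → Par) → LNS → LNS
renL ρ = map (renC ρ)

module _ (ρ : Par → Par) where

  renT-substT : ∀ x a t → renT ρ (substT x a t) ≡ substT x (ρ a) (renT ρ t)
  renT-substT x a (var y) with x ≟ y
  ... | yes _ = refl
  ... | no  _ = refl
  renT-substT x a (par b) = refl

  renF-subst : ∀ x a A → renF ρ (A [ a / x ]) ≡ renF ρ A [ ρ a / x ]
  renF-subst x a ⊥′          = refl
  renF-subst x a (atom p ts) = cong (atom p) (begin
    map (renT ρ) (map (substT x a) ts)        ≡⟨ map-∘ ts ⟨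
    map (renT ρ ∘ substT x a) ts              ≡⟨ map-cong (renT-substT x a) ts ⟩
    map (substT x (ρ a) ∘ renT ρ) ts          ≡⟨ map-∘ ts ⟩
    map (substT x (ρ a)) (map (renT ρ) ts)    ∎)
    where open ≡-Reasoning
  renF-subst x a (A ∧′ B) = cong₂ _∧′_ (renF-subst x a A) (renF-subst x a B)
  renF-subst x a (A ∨′ B) = cong₂ _∨′_ (renF-subst x a A) (renF-subst x a B)
  renF-subst x a (A ⊃ B)  = cong₂ _⊃_ (renF-subst x a A) (renF-subst x a B)
  renF-subst x a (∀′ y A) with x ≟ y
  ... | yes _ = refl
  ... | no  _ = cong (∀′ y) (renF-subst x a A)
  renF-subst x a (∃′ y A) with x ≟ y
  ... | yes _ = refl
  ... | no  _ = cong (∃′ y) (renF-subst x a A)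

  ++-map : ∀ {xs ys xs′ ys′} → xs′ ≡ map ρ xs → ys′ ≡ map ρ ys → xs′ ++ ys′ ≡ map ρ (xs ++ ys)
  ++-map {xs} {ys} e₁ e₂ = trans (cong₂ _++_ e₁ e₂) (sym (map-++ ρ xs ys))

  concatMap-map-natural : ∀ {X : Set} {f : X → List Par} {g : X → X} →
                          (∀ x → f (g x) ≡ map ρ (f x)) →
                          ∀ xs → concatMap f (map g xs) ≡ map ρ (concatMap f xs)
  concatMap-map-natural eq []       = refl
  concatMap-map-natural eq (x ∷ xs) = ++-map (eq x) (concatMap-map-natural eq xs)

  parsF-renF : ∀ A → parsF (renF ρ A) ≡ map ρ (parsF A)
  parsF-renF ⊥′          = refl
  parsF-renF (atom p ts) = concatMap-map-natural (λ { (var _) → refl ; (par _) → refl }) ts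
  parsF-renF (A ∧′ B)    = ++-map (parsF-renF A) (parsF-renF B)
  parsF-renF (A ∨′ B)    = ++-map (parsF-renF A) (parsF-renF B)
  parsF-renF (A ⊃ B)     = ++-map (parsF-renF A) (parsF-renF B)
  parsF-renF (∀′ y A)    = parsF-renF A
  parsF-renF (∃′ y A)    = parsF-renF A

  parsL-renL : ∀ S → parsL (renL ρ S) ≡ map ρ (parsL S)
  parsL-renL = concatMap-map-natural parsC-renC
    where
    parsC-renC : ∀ C → parsC (renC ρ C) ≡ map ρ (parsC C)
    parsC-renC (Γ ⊢ Δ) = ++-map (concatMap-map-natural parsF-renF Γ) (concatMap-map-natural parsF-renF Δ)

  ∉-renL : Injective _≡_ _≡_ ρ → ∀ {b} S → b ∉ parsL S → ρ b ∉ parsL (renL ρ S)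
  ∉-renL inj S b∉ ρb∈ with ∈-map⁻ ρ (cast (ρ _ ∈_) (parsL-renL S) ρb∈)
  ... | _ , p∈ , ρb≡ρp = b∉ (cast (_∈ parsL S) (sym (inj ρb≡ρp)) p∈)

  renF-local-id : ∀ A → All (λ p → ρ p ≡ p) (parsF A) → renF ρ A ≡ A
  renF-local-id ⊥′          _   = refl
  renF-local-id (atom p ts) fix = cong (atom p) (map-id-local (All.map renT-local-id (All-concatMap⁻ ts fix)))
    where
    renT-local-id : ∀ {t} → All (λ p → ρ p ≡ p) (parsT t) → renT ρ t ≡ t
    renT-local-id {var _} _        = refl
    renT-local-id {par _} (e ∷ []) = cong par e
  renF-local-id (A ∧′ B) fix = cong₂ _∧′_ (renF-local-id A (++⁻ˡ _ fix)) (renF-local-id B (++⁻ʳ (parsF A) fix))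
  renF-local-id (A ∨′ B) fix = cong₂ _∨′_ (renF-local-id A (++⁻ˡ _ fix)) (renF-local-id B (++⁻ʳ (parsF A) fix))
  renF-local-id (A ⊃ B)  fix = cong₂ _⊃_ (renF-local-id A (++⁻ˡ _ fix)) (renF-local-id B (++⁻ʳ (parsF A) fix))
  renF-local-id (∀′ y A) fix = cong (∀′ y) (renF-local-id A fix)
  renF-local-id (∃′ y A) fix = cong (∃′ y) (renF-local-id A fix)

map-inverse : ∀ {X : Set} {f g : X → X} → (∀ x → g (f x) ≡ x) → ∀ xs → map g (map f xs) ≡ xs
map-inverse inv xs = trans (sym (map-∘ xs)) (trans (map-cong inv xs) (map-id xs))

renF-inverse : ∀ {ρ ρ′ : Par → Par} → (∀ p → ρ′ (ρ p) ≡ p) → ∀ A → renF ρ′ (renF ρ A) ≡ A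
renF-inverse inv ⊥′          = refl
renF-inverse inv (atom p ts) = cong (atom p) (map-inverse (λ { (var _) → refl ; (par b) → cong par (inv b) }) ts)
renF-inverse inv (A ∧′ B)    = cong₂ _∧′_ (renF-inverse inv A) (renF-inverse inv B)
renF-inverse inv (A ∨′ B)    = cong₂ _∨′_ (renF-inverse inv A) (renF-inverse inv B)
renF-inverse inv (A ⊃ B)     = cong₂ _⊃_ (renF-inverse inv A) (renF-inverse inv B)
renF-inverse inv (∀′ y A)    = cong (∀′ y) (renF-inverse inv A)
renF-inverse inv (∃′ y A)    = cong (∃′ y) (renF-inverse inv A)

renL-inverse : ∀ {ρ ρ′ : Par → Par} → (∀ p → ρ′ (ρ p) ≡ p) → ∀ S → renL ρ′ (renL ρ S) ≡ S
renL-inverse inv = map-inverse λ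
  { (Γ ⊢ Δ) → cong₂ _⊢_ (map-inverse (renF-inverse inv) Γ) (map-inverse (renF-inverse inv) Δ) }

module _ {ρ : Par → Par} (ρ-injective : Injective _≡_ _≡_ ρ) where

  private
    pull : ∀ G {X} → LNIF (renL ρ (G ++ X)) → LNIF (renL ρ G ++ renL ρ X)
    pull G {X} = cast LNIF (map-++ (renC ρ) G X)

    push : ∀ G {X} → LNIF (renL ρ G ++ renL ρ X) → LNIF (renL ρ (G ++ X))
    push G {X} = cast LNIF (sym (map-++ (renC ρ) G X))

    fresh : ∀ {b} G {X} → Fresh b (G ++ X) → Fresh (ρ b) (renL ρ G ++ renL ρ X)
    fresh G {X} fr = cast (Fresh _) (map-++ (renC ρ) G X) (∉-renL ρ ρ-injective (G ++ X) fr)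

  renL-LNIF : ∀ {S} → LNIF S → LNIF (renL ρ S)
  renL-LNIF (perm S≈S′ d) = perm (renL-≈ S≈S′) (renL-LNIF d)
    where
    renL-≈ : ∀ {S S′} → S ≈L S′ → renL ρ S ≈L renL ρ S′
    renL-≈ [] = []
    renL-≈ {(_ ⊢ _) ∷ _} {(_ ⊢ _) ∷ _} ((Γ↭ , Δ↭) ∷ S≈) = (↭.map⁺ (renF ρ) Γ↭ , ↭.map⁺ (renF ρ) Δ↭) ∷ renL-≈ S≈
  renL-LNIF (id₁ G H Γ Δ p ts) = push G (id₁ _ _ _ _ p _)
  renL-LNIF (id₂ G H F Γ₁ Δ₁ Γ₂ Δ₂ p ts) =
    push G (cast (λ X → LNIF (renL ρ G ++ _ ∷ X)) (sym (map-++ (renC ρ) H _)) (id₂ _ _ _ _ _ _ _ p _))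
  renL-LNIF (⊥l G H Γ Δ)  = push G (⊥l _ _ _ _)
  renL-LNIF (∧l {G} d)    = push G (∧l (pull G (renL-LNIF d)))
  renL-LNIF (∨r {G} d)    = push G (∨r (pull G (renL-LNIF d)))
  renL-LNIF (∧r {G} d e)  = push G (∧r (pull G (renL-LNIF d)) (pull G (renL-LNIF e)))
  renL-LNIF (∨l {G} d e)  = push G (∨l (pull G (renL-LNIF d)) (pull G (renL-LNIF e)))
  renL-LNIF (⊃r₁ {G} d)   = push G (⊃r₁ (pull G (renL-LNIF d)))
  renL-LNIF (⊃l {G} d e)  = push G (⊃l (pull G (renL-LNIF d)) (pull G (renL-LNIF e)))
  renL-LNIF (lift {G} d)  = push G (lift (pull G (renL-LNIF d)))
  renL-LNIF (⊃r₂ {G} d e) = push G (⊃r₂ (pull G (renL-LNIF d)) (pull G (renL-LNIF e)))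
  renL-LNIF (∀l {G} {x = x} {A} a d) with pull G (renL-LNIF d)
  ... | d′ rewrite renF-subst ρ x a A = push G (∀l (ρ a) d′)
  renL-LNIF (∃r {G} {x = x} {A} a d) with pull G (renL-LNIF d)
  ... | d′ rewrite renF-subst ρ x a A = push G (∃r (ρ a) d′)
  renL-LNIF (∀r₁ {G} {x = x} {A} a fr d) with pull G (renL-LNIF d)
  ... | d′ rewrite renF-subst ρ x a A = push G (∀r₁ (ρ a) (fresh G fr) d′)
  renL-LNIF (∃l {G} {x = x} {A} a fr d) with pull G (renL-LNIF d)
  ... | d′ rewrite renF-subst ρ x a A = push G (∃l (ρ a) (fresh G fr) d′)
  renL-LNIF (∀r₂ {G} {x = x} {A} a fr d e) with pull G (renL-LNIF d)
  ... | d′ rewrite renF-subst ρ x a A = push G (∀r₂ (ρ a) (fresh G fr) d′ (pull G (renL-LNIF e)))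

transpose : Par → Par → Par → Par
transpose c d p with p ≟ c | p ≟ d
... | yes _ | _     = d
... | no _  | yes _ = c
... | no _  | no _  = p

transpose-ˡ : ∀ c d → transpose c d c ≡ d
transpose-ˡ c d with c ≟ c
... | yes _  = refl
... | no c≢c = ⊥-elim (c≢c refl)

transpose-ʳ : ∀ c d → transpose c d d ≡ c
transpose-ʳ c d with d ≟ c | d ≟ d
... | yes refl | _      = refl
... | no _     | yes _  = refl
... | no _     | no d≢d = ⊥-elim (d≢d refl)

transpose-other : ∀ {c d p} → c ≢ p → d ≢ p → transpose c d p ≡ p
transpose-other {c} {d} {p} c≢p d≢p with p ≟ c | p ≟ d
... | yes p≡c | _       = ⊥-elim (c≢p (sym p≡c))
... | no _    | yes p≡d = ⊥-elim (d≢p (sym p≡d))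
... | no _    | no _    = refl

transpose-involutive : ∀ c d p → transpose c d (transpose c d p) ≡ p
transpose-involutive c d p with p ≟ c | p ≟ d
... | yes refl | _        = transpose-ʳ c d
... | no p≢c   | yes refl = transpose-ˡ c d
... | no p≢c   | no p≢d   = transpose-other (p≢c ∘ sym) (p≢d ∘ sym)

transpose-injective : ∀ c d → Injective _≡_ _≡_ (transpose c d)
transpose-injective c d {p} {q} e =
  trans (sym (transpose-involutive c d p)) (trans (cong (transpose c d) e) (transpose-involutive c d q))

transpose-cases : ∀ c d p → d ≢ p → (p ≡ c × transpose c d p ≡ d) ⊎ (p ≢ c × transpose c d p ≡ p)
transpose-cases c d p d≢p with p ≟ c | p ≟ d
... | yes p≡c | _       = inj₁ (p≡c , refl)
... | no p≢c  | yes p≡d = ⊥-elim (d≢p (sym p≡d))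
... | no p≢c  | no _    = inj₂ (p≢c , refl)

untranspose : ∀ c d {T} → LNIF (renL (transpose c d) T) → LNIF T
untranspose c d {T} der = cast LNIF (renL-inverse (transpose-involutive c d) T) (renL-LNIF (transpose-injective c d) der)

-- Freshness

∈⇒≤sum : ∀ {n ns} → n ∈ ns → n ≤ sum ns
∈⇒≤sum {ns = m ∷ ms} (here refl) = m≤m+n m (sum ms)
∈⇒≤sum {ns = m ∷ ms} (there n∈)  = ≤-trans (∈⇒≤sum n∈) (m≤n+m (sum ms) m)

fresh-for : (ps : List Par) → ∃ (_∉ ps)
fresh-for ps = suc (sum ps) , λ p∈ → n≮n (sum ps) (∈⇒≤sum p∈)

∉-++⁻ : ∀ {b : Par} xs {ys} → b ∉ xs ++ ys → b ∉ xs × b ∉ ys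
∉-++⁻ xs b∉ = b∉ ∘ ∈-++⁺ˡ , b∉ ∘ ∈-++⁺ʳ xs

FreshF : Par → Formula → Set
FreshF b A = All (b ≢_) (parsF A)

FreshΓ : Par → List Formula → Set
FreshΓ b = All (FreshF b)

FreshC : Par → Component → Set
FreshC b (Γ ⊢ Δ) = FreshΓ b Γ × FreshΓ b Δ

FreshL : Par → LNS → Set
FreshL b = All (FreshC b)

module _ {b : Par} where

  Fresh⇒FreshL : ∀ S → Fresh b S → FreshL b S
  Fresh⇒FreshL S b∉ = All.map component (All-concatMap⁻ S (¬Any⇒All¬ _ b∉))
    where
    component : ∀ {C} → All (b ≢_) (parsC C) → FreshC b C
    component {Γ ⊢ Δ} fr with ++⁻ (concatMap parsF Γ) fr
    ... | frΓ , frΔ = All-concatMap⁻ Γ frΓ , All-concatMap⁻ Δ frΔ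

  FreshL⇒Fresh : ∀ {S} → FreshL b S → Fresh b S
  FreshL⇒Fresh fr = All¬⇒¬Any (All-concatMap⁺ (All.map component fr))
    where
    component : ∀ {C} → FreshC b C → All (b ≢_) (parsC C)
    component {Γ ⊢ Δ} (frΓ , frΔ) = ++⁺ (All-concatMap⁺ frΓ) (All-concatMap⁺ frΔ)

  FreshL-resp-≈ : ∀ {S S′} → S ≈L S′ → FreshL b S′ → FreshL b S
  FreshL-resp-≈ [] [] = []
  FreshL-resp-≈ {(_ ⊢ _) ∷ _} {(_ ⊢ _) ∷ _} ((Γ↭ , Δ↭) ∷ S≈) ((frΓ , frΔ) ∷ fr) =
    (↭.All-resp-↭ (↭-sym Γ↭) frΓ , ↭.All-resp-↭ (↭-sym Δ↭) frΔ) ∷ FreshL-resp-≈ S≈ fr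

  Fresh-resp-≈ : ∀ {S S′} → S ≈L S′ → Fresh b S′ → Fresh b S
  Fresh-resp-≈ {S′ = S′} S≈S′ = FreshL⇒Fresh ∘ FreshL-resp-≈ S≈S′ ∘ Fresh⇒FreshL S′

  FreshF-subst : ∀ {c} x A → b ≢ c → FreshF b A → FreshF b (A [ c / x ])
  FreshF-subst x ⊥′ b≢c fr = fr
  FreshF-subst {c} x (atom p ts) b≢c fr =
    cast (All (b ≢_)) (sym (concatMap-map parsT (substT x c) ts)) (All-concatMap⁺ (All.map term (All-concatMap⁻ ts fr)))
    where
    term : ∀ {t} → All (b ≢_) (parsT t) → All (b ≢_) (parsT (substT x c t))
    term {var y} _ with x ≟ y
    ... | yes _ = b≢c ∷ []
    ... | no _  = []
    term {par _} fr = fr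
  FreshF-subst x (A ∧′ B) b≢c fr = ++⁺ (FreshF-subst x A b≢c (++⁻ˡ _ fr)) (FreshF-subst x B b≢c (++⁻ʳ (parsF A) fr))
  FreshF-subst x (A ∨′ B) b≢c fr = ++⁺ (FreshF-subst x A b≢c (++⁻ˡ _ fr)) (FreshF-subst x B b≢c (++⁻ʳ (parsF A) fr))
  FreshF-subst x (A ⊃ B)  b≢c fr = ++⁺ (FreshF-subst x A b≢c (++⁻ˡ _ fr)) (FreshF-subst x B b≢c (++⁻ʳ (parsF A) fr))
  FreshF-subst x (∀′ y A) b≢c fr with x ≟ y
  ... | yes _ = fr
  ... | no _  = FreshF-subst x A b≢c fr
  FreshF-subst x (∃′ y A) b≢c fr with x ≟ y
  ... | yes _ = fr
  ... | no _  = FreshF-subst x A b≢c fr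

module _ {c d : Par} where

  renF-transpose-fresh : ∀ A → FreshF c A → FreshF d A → renF (transpose c d) A ≡ A
  renF-transpose-fresh A frc frd =
    renF-local-id (transpose c d) A (All.zipWith (λ (c≢ , d≢) → transpose-other c≢ d≢) (frc , frd))

  renΓ-transpose-fresh : ∀ {Γ} → FreshΓ c Γ → FreshΓ d Γ → map (renF (transpose c d)) Γ ≡ Γ
  renΓ-transpose-fresh frc frd = map-id-local (All.zipWith (λ (frc , frd) → renF-transpose-fresh _ frc frd) (frc , frd))

  renL-transpose-fresh : ∀ {S} → FreshL c S → FreshL d S → renL (transpose c d) S ≡ S
  renL-transpose-fresh frc frd = map-id-local (All.zipWith component (frc , frd))
    where
    component : ∀ {C} → FreshC c C × FreshC d C → renC (transpose c d) C ≡ C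
    component {Γ ⊢ Δ} ((frcΓ , frcΔ) , (frdΓ , frdΔ)) =
      cong₂ _⊢_ (renΓ-transpose-fresh frcΓ frdΓ) (renΓ-transpose-fresh frcΔ frdΔ)

FreshL-update : ∀ {b} G X {X′ H} → (FreshL b X → FreshL b X′) → FreshL b (G ++ X ++ H) → FreshL b (G ++ X′ ++ H)
FreshL-update G X k fr with ++⁻ G fr
... | frG , frXH with ++⁻ X frXH
...   | frX , frH = ++⁺ frG (++⁺ (k frX) frH)

FreshL-local : ∀ {b} G {H Γ Δ} Pc Qc {P Q} → (FreshΓ b Pc → FreshΓ b P) → (FreshΓ b Qc → FreshΓ b Q) →
               FreshL b (G ++ (Pc ++ Γ ⊢ Qc ++ Δ) ∷ H) → FreshL b (G ++ (P ++ Γ ⊢ Q ++ Δ) ∷ H)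
FreshL-local G Pc Qc kP kQ = FreshL-update G (_ ∷ []) λ
  { ((frΓ , frΔ) ∷ []) → (++⁺ (kP (++⁻ˡ Pc frΓ)) (++⁻ʳ Pc frΓ) , ++⁺ (kQ (++⁻ˡ Qc frΔ)) (++⁻ʳ Qc frΔ)) ∷ [] }

FreshL-extract : ∀ {b} G {Γ Q Δ X} N → (FreshF b Q → FreshC b N) →
                 FreshL b (G ++ (Γ ⊢ Q ∷ Δ) ∷ X) → FreshL b (G ++ (Γ ⊢ Δ) ∷ N ∷ X)
FreshL-extract G N k = FreshL-update G (_ ∷ []) λ { ((frΓ , frQ ∷ frΔ) ∷ []) → (frΓ , frΔ) ∷ k frQ ∷ [] }

FreshL-⊃ : ∀ {b} G {Γ C D Δ X} →
           FreshL b (G ++ (Γ ⊢ (C ⊃ D) ∷ Δ) ∷ X) → FreshL b (G ++ (Γ ⊢ Δ) ∷ (C ∷ [] ⊢ D ∷ []) ∷ X)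
FreshL-⊃ G {C = C} = FreshL-extract G _ λ frCD → ++⁻ˡ (parsF C) frCD ∷ [] , ++⁻ʳ (parsF C) frCD ∷ []

FreshL-∀ : ∀ {a b} G {Γ y B Δ X} → a ≢ b →
           FreshL a (G ++ (Γ ⊢ ∀′ y B ∷ Δ) ∷ X) → FreshL a (G ++ (Γ ⊢ Δ) ∷ ([] ⊢ B [ b / y ] ∷ []) ∷ X)
FreshL-∀ G {y = y} {B} a≢b = FreshL-extract G _ λ frB → [] , FreshF-subst y B a≢b frB ∷ []

FreshL-move : ∀ {b} G {Γ₁ Q Δ₁ Γ₂ Δ₂ X} →
              FreshL b (G ++ (Γ₁ ⊢ Q ∷ Δ₁) ∷ (Γ₂ ⊢ Δ₂) ∷ X) → FreshL b (G ++ (Γ₁ ⊢ Δ₁) ∷ (Γ₂ ⊢ Q ∷ Δ₂) ∷ X)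
FreshL-move G = FreshL-update G (_ ∷ _ ∷ []) λ
  { ((frΓ₁ , frQ ∷ frΔ₁) ∷ (frΓ₂ , frΔ₂) ∷ []) → (frΓ₁ , frΔ₁) ∷ (frΓ₂ , frQ ∷ frΔ₂) ∷ [] }

Fresh-move : ∀ {b} G {Γ₁ Q Δ₁ Γ₂ Δ₂ X} →
             Fresh b (G ++ (Γ₁ ⊢ Q ∷ Δ₁) ∷ (Γ₂ ⊢ Δ₂) ∷ X) → Fresh b (G ++ (Γ₁ ⊢ Δ₁) ∷ (Γ₂ ⊢ Q ∷ Δ₂) ∷ X)
Fresh-move G = FreshL⇒Fresh ∘ FreshL-move G ∘ Fresh⇒FreshL _

FreshL-lift : ∀ {b} G {C Γ₁ Δ₁ Γ₂ Δ₂ X} →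
              FreshL b (G ++ (C ∷ Γ₁ ⊢ Δ₁) ∷ (Γ₂ ⊢ Δ₂) ∷ X) → FreshL b (G ++ (C ∷ Γ₁ ⊢ Δ₁) ∷ (C ∷ Γ₂ ⊢ Δ₂) ∷ X)
FreshL-lift G = FreshL-update G (_ ∷ _ ∷ []) λ
  { ((frC ∷ frΓ₁ , frΔ₁) ∷ (frΓ₂ , frΔ₂) ∷ []) → (frC ∷ frΓ₁ , frΔ₁) ∷ (frC ∷ frΓ₂ , frΔ₂) ∷ [] }

-- Transforms

data Stage : Set where
  before owing settled : Stage

rank : Stage → ℕ
rank before  = 0
rank owing   = 1
rank settled = 2

_≼_ : List Formula → List Formula → Set
Γ ≼ Γ′ = ∃ λ E → Γ′ ↭ E ++ Γ

data SuccedentStep (x : Var) (A : Formula) : Stage → Stage → List Formula → List Formula → Set where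
  keep : ∀ {s Δ Δ′} → Δ ↭ Δ′ → SuccedentStep x A s s Δ Δ′
  take : ∀ {Δ Δ′} → Δ ↭ ∀′ x A ∷ Δ′ → SuccedentStep x A before owing Δ Δ′
  give : ∀ {Δ Δ′} → ∀′ x A ∷ Δ ↭ Δ′ → SuccedentStep x A owing settled Δ Δ′

data Insertion (x : Var) (A : Formula) (a : Par) : Stage → Stage → LNS → Set where
  none : ∀ {s} → Insertion x A a s s []
  new  : ∀ E → Insertion x A a owing settled ((E ⊢ A [ a / x ] ∷ []) ∷ [])

data Transform (x : Var) (A : Formula) (a : Par) : Stage → Stage → LNS → LNS → Set where
  []   : ∀ {s} → Transform x A a s s [] []
  step : ∀ {s s₁ s₂ s′ Γ Δ Γ′ Δ′ I S T} →
         Γ ≼ Γ′ → SuccedentStep x A s s₁ Δ Δ′ → Insertion x A a s₁ s₂ I → Transform x A a s₂ s′ S T →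
         Transform x A a s s′ ((Γ ⊢ Δ) ∷ S) ((Γ′ ⊢ Δ′) ∷ I ++ T)

module _ {x : Var} {A : Formula} where

  step-++ˡ : ∀ {s s₁ Δ Δ′} Q → SuccedentStep x A s s₁ Δ Δ′ → SuccedentStep x A s s₁ (Q ++ Δ) (Q ++ Δ′)
  step-++ˡ Q (keep p) = keep (↭.++⁺ˡ Q p)
  step-++ˡ Q (take p) = take (↭-trans (↭.++⁺ˡ Q p) (↭.shift _ Q _))
  step-++ˡ Q (give p) = give (↭-trans (↭-sym (↭.shift _ Q _)) (↭.++⁺ˡ Q p))

  data StepView (s s₁ : Stage) (C : Formula) (Δ Δ′ : List Formula) : Set where
    side      : ∀ Δ″ → SuccedentStep x A s s₁ Δ Δ″ → Δ′ ↭ C ∷ Δ″ → StepView s s₁ C Δ Δ′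
    principal : C ≡ ∀′ x A → s ≡ before → s₁ ≡ owing → Δ ↭ Δ′ → StepView s s₁ C Δ Δ′

  -- Whether C is the occurrence being taken is read off the permutation, so no decidable
  -- equality of formulas is needed.
  view-step : ∀ {s s₁ C Δ Δ′} → SuccedentStep x A s s₁ (C ∷ Δ) Δ′ → StepView s s₁ C Δ Δ′
  view-step (keep p) = side _ (keep ↭-refl) (↭-sym p)
  view-step (give p) = side _ (give ↭-refl) (↭-trans (↭-sym p) (swap _ _ ↭-refl))
  view-step {C = C} (take p) with ↭.∈-resp-↭ (↭-sym p) (here refl)
  ... | here refl = principal refl refl refl (↭.drop-∷ p)
  ... | there ∀xA∈Δ with ∈-∃++ ∀xA∈Δ
  ...   | Δ₁ , Δ₂ , refl =
    side (Δ₁ ++ Δ₂) (take (↭.shift _ Δ₁ Δ₂))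
      (↭.drop-∷ (↭-trans (↭-sym p) (↭-trans (prep C (↭.shift _ Δ₁ Δ₂)) (swap _ _ ↭-refl))))

  side-step : ∀ {s s₁ C Δ Δ′} → C ≢ ∀′ x A → SuccedentStep x A s s₁ (C ∷ Δ) Δ′ →
              ∃ λ Δ″ → SuccedentStep x A s s₁ Δ Δ″ × Δ′ ↭ C ∷ Δ″
  side-step C≢∀xA st with view-step st
  ... | side Δ″ st′ Δ′↭           = Δ″ , st′ , Δ′↭
  ... | principal C≡∀xA _ _ _     = ⊥-elim (C≢∀xA C≡∀xA)

  side-steps : ∀ {s s₁ Δ Δ′} Q → All (_≢ ∀′ x A) Q → SuccedentStep x A s s₁ (Q ++ Δ) Δ′ →
               ∃ λ Δ″ → SuccedentStep x A s s₁ Δ Δ″ × Δ′ ↭ Q ++ Δ″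
  side-steps [] [] st = _ , st , ↭-refl
  side-steps (C ∷ Q) (C≢ ∷ Q≢) st with side-step C≢ st
  ... | Δ₁ , st₁ , Δ′↭ with side-steps Q Q≢ st₁
  ...   | Δ″ , st″ , Δ₁↭ = Δ″ , st″ , ↭-trans Δ′↭ (prep C Δ₁↭)

module _ {x : Var} {A : Formula} {a : Par} where

  data Split (s s′ : Stage) (G Y : LNS) : LNS → Set where
    splits : ∀ {s₁ T₁ T₂} → Transform x A a s s₁ G T₁ → Transform x A a s₁ s′ Y T₂ → Split s s′ G Y (T₁ ++ T₂)

  split : ∀ G {s s′ Y T} → Transform x A a s s′ (G ++ Y) T → Split s s′ G Y T
  split [] r = splits [] r
  split (_ ∷ G) (step {I = I} w st ins r) with split G r
  ... | splits {T₁ = T₁} {T₂} r₁ r₂ =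
    cast (Split _ _ _ _) (cong (_ ∷_) (++-assoc I T₁ T₂)) (splits (step w st ins r₁) r₂)

  infixr 5 _++ᵀ_
  _++ᵀ_ : ∀ {s s₁ s′ G Y T₁ T₂} → Transform x A a s s₁ G T₁ → Transform x A a s₁ s′ Y T₂ →
          Transform x A a s s′ (G ++ Y) (T₁ ++ T₂)
  [] ++ᵀ r = r
  _++ᵀ_ {T₂ = T₂} (step {I = I} {T = T} w st ins r₁) r₂ =
    cast (Transform x A a _ _ _) (cong (_ ∷_) (sym (++-assoc I T T₂))) (step w st ins (r₁ ++ᵀ r₂))

  identity : ∀ {s} S → Transform x A a s s S S
  identity []            = []
  identity ((Γ ⊢ Δ) ∷ S) = step ([] , ↭-refl) (keep ↭-refl) none (identity S)

  untouched : ∀ {s s′ C S T} → Transform x A a s s′ S T → Transform x A a s s′ (C ∷ S) (C ∷ T)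
  untouched {C = _ ⊢ _} = step ([] , ↭-refl) (keep ↭-refl) none

  insert-after : ∀ {s′ C S T} E → Transform x A a settled s′ S T →
                 Transform x A a owing s′ (C ∷ S) (C ∷ (E ⊢ A [ a / x ] ∷ []) ∷ T)
  insert-after {C = _ ⊢ _} E = step ([] , ↭-refl) (keep ↭-refl) (new E)

  prepend-succedent : ∀ {s s′ Γ Δ Γ′ Δ′ S T} Q → Transform x A a s s′ ((Γ ⊢ Δ) ∷ S) ((Γ′ ⊢ Δ′) ∷ T) →
                      Transform x A a s s′ ((Γ ⊢ Q ++ Δ) ∷ S) ((Γ′ ⊢ Q ++ Δ′) ∷ T)
  prepend-succedent Q (step w st ins r) = step w (step-++ˡ Q st) ins r

  prepend-antecedent : ∀ {s s′ Γ Δ Γ′ Δ′ S T} C → Transform x A a s s′ ((Γ ⊢ Δ) ∷ S) ((Γ′ ⊢ Δ′) ∷ T) →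
                       Transform x A a s s′ ((C ∷ Γ ⊢ Δ) ∷ S) ((C ∷ Γ′ ⊢ Δ′) ∷ T)
  prepend-antecedent C (step (E , Γ′↭) st ins r) = step (E , ↭-trans (prep C Γ′↭) (↭.shifts (C ∷ []) E)) st ins r

  transform-resp-≈ : ∀ {s s′ S S₀ T} → S ≈L S₀ → Transform x A a s s′ S₀ T → Transform x A a s s′ S T
  transform-resp-≈ [] [] = []
  transform-resp-≈ {S = (_ ⊢ _) ∷ _} {(_ ⊢ _) ∷ _} ((Γ↭ , Δ↭) ∷ S≈) (step (E , Γ′↭) st ins r) =
    step (E , ↭-trans Γ′↭ (↭.++⁺ˡ E (↭-sym Γ↭))) (step-resp-↭ st) ins (transform-resp-≈ S≈ r)
    where
    step-resp-↭ : ∀ {s s₁ Δ′} → SuccedentStep x A s s₁ _ Δ′ → SuccedentStep x A s s₁ _ Δ′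
    step-resp-↭ (keep p) = keep (↭-trans Δ↭ p)
    step-resp-↭ (take p) = take (↭-trans Δ↭ p)
    step-resp-↭ (give p) = give (↭-trans (prep _ Δ↭) p)

  rank-mono : ∀ {s s′ S T} → Transform x A a s s′ S T → rank s ≤ rank s′
  rank-mono []                = ≤-refl
  rank-mono (step _ st ins r) = ≤-trans (step-mono st) (≤-trans (insertion-mono ins) (rank-mono r))
    where
    step-mono : ∀ {s s₁ Δ Δ′} → SuccedentStep x A s s₁ Δ Δ′ → rank s ≤ rank s₁
    step-mono (keep _) = ≤-refl
    step-mono (take _) = z≤n
    step-mono (give _) = s≤s z≤n
    insertion-mono : ∀ {s s₁ I} → Insertion x A a s s₁ I → rank s ≤ rank s₁
    insertion-mono none    = ≤-refl
    insertion-mono (new _) = s≤s z≤n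

  settled-final : ∀ {s′ S T} → Transform x A a settled s′ S T → s′ ≡ settled
  settled-final {before}  r with rank-mono r
  ... | ()
  settled-final {owing}   r with rank-mono r
  ... | s≤s ()
  settled-final {settled} r = refl

  weakening : ∀ {s S T x′ A′ a′} → s ≢ owing → Transform x A a s s S T → Transform x′ A′ a′ before before S T
  weakening s≢owing []                          = []
  weakening s≢owing (step w (keep Δ↭) none r)   = step w (keep Δ↭) none (weakening s≢owing r)
  weakening s≢owing (step w (keep _) (new _) r) = ⊥-elim (s≢owing refl)
  weakening s≢owing (step w (give _) _ r)       = ⊥-elim (s≢owing refl)
  weakening s≢owing (step w (take _) none r) with rank-mono r
  ... | ()
  weakening s≢owing (step w (take _) (new _) r) with rank-mono r
  ... | ()

renL-transform : ∀ ρ {x A a s s′ S T} → Transform x A a s s′ S T →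
                 Transform x (renF ρ A) (ρ a) s s′ (renL ρ S) (renL ρ T)
renL-transform ρ [] = []
renL-transform ρ {x} {A} {a} (step {Γ = Γ} {I = I} {T = T} (E , Γ′↭) st ins r) =
  cast (Transform x _ _ _ _ _) (cong (_ ∷_) (sym (map-++ (renC ρ) I T)))
    (step (map (renF ρ) E , ↭-trans (↭.map⁺ (renF ρ) Γ′↭) (↭-reflexive (map-++ (renF ρ) E Γ)))
          (renL-step st) (renL-insertion ins) (renL-transform ρ r))
  where
  renL-step : ∀ {s s₁ Δ Δ′} → SuccedentStep x A s s₁ Δ Δ′ →
              SuccedentStep x (renF ρ A) s s₁ (map (renF ρ) Δ) (map (renF ρ) Δ′)
  renL-step (keep p) = keep (↭.map⁺ (renF ρ) p)
  renL-step (take p) = take (↭.map⁺ (renF ρ) p)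
  renL-step (give p) = give (↭.map⁺ (renF ρ) p)
  renL-insertion : ∀ {s s₁ I} → Insertion x A a s s₁ I → Insertion x (renF ρ A) (ρ a) s s₁ (renL ρ I)
  renL-insertion none    = none
  renL-insertion (new E) =
    cast (λ B → Insertion x _ _ _ _ ((map (renF ρ) E ⊢ B ∷ []) ∷ [])) (sym (renF-subst ρ x a A)) (new _)

module _ {S : LNS} {c d : Par} (c-fresh : FreshL c S) (d-fresh : FreshL d S) where

  transpose-transform : ∀ {x A a s s′ T} → Transform x A a s s′ S T →
                        Transform x (renF (transpose c d) A) (transpose c d a) s s′ S (renL (transpose c d) T)
  transpose-transform r =
    cast (λ S′ → Transform _ _ _ _ _ S′ _) (renL-transpose-fresh c-fresh d-fresh) (renL-transform _ r)

-- Transforms of derivable sequents are derivable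

TransformsDerivable : LNS → Set
TransformsDerivable S = ∀ x A a {s′} T → Transform x A a before s′ S T → s′ ≢ owing → FreshL a S → LNIF T

avoiding : ∀ {S} (L : List Par) →
           (∀ x A a {s′} T → Transform x A a before s′ S T → s′ ≢ owing → FreshL a S → a ∉ L → LNIF T) →
           TransformsDerivable S
avoiding {S} L k x A a {s′} T r done a-fresh with fresh-for (parsL S ++ L)
... | a′ , a′∉ with ∉-++⁻ (parsL S) a′∉
...   | a′∉S , a′∉L = untranspose a a′ (k x _ a′ _ r′ done a′-fresh a′∉L)
  where
  a′-fresh : FreshL a′ S
  a′-fresh = Fresh⇒FreshL S a′∉S
  r′ : Transform x (renF (transpose a a′) A) a′ before s′ S (renL (transpose a a′) T)
  r′ = cast (λ p → Transform x (renF (transpose a a′) A) p before s′ S (renL (transpose a a′) T)) (transpose-ˡ a a′)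
            (transpose-transform a-fresh a′-fresh r)

-- The eigenvariable b may occur in T or equal a; transposing b with a parameter fresh for
-- everything removes both clashes and fixes S.
avoiding-eigenvariable :
  ∀ {S} b → b ∉ parsL S →
  (∀ x A a {s′} T → Transform x A a before s′ S T → s′ ≢ owing → FreshL a S → b ∉ parsL T → a ≢ b → LNIF T) →
  TransformsDerivable S
avoiding-eigenvariable {S} b b∉S k x A a {s′} T r done a-fresh with fresh-for (parsL T ++ parsL S ++ a ∷ b ∷ [])
... | b′ , b′∉ with ∉-++⁻ (parsL T) b′∉
...   | b′∉T , b′∉ with ∉-++⁻ (parsL S) b′∉
...     | b′∉S , b′∉ab = untranspose b b′ (k x _ (σ a) _ r′ done σa-fresh b∉σT σa≢b)
  where
  σ : Par → Par
  σ = transpose b b′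
  b′-fresh : FreshL b′ S
  b′-fresh = Fresh⇒FreshL S b′∉S
  r′ : Transform x (renF σ A) (σ a) before s′ S (renL σ T)
  r′ = transpose-transform (Fresh⇒FreshL S b∉S) b′-fresh r
  b∉σT : b ∉ parsL (renL σ T)
  b∉σT = cast (_∉ parsL (renL σ T)) (transpose-ʳ b b′) (∉-renL σ (transpose-injective b b′) T b′∉T)
  σa-fresh : FreshL (σ a) S
  σa-fresh with transpose-cases b b′ a (b′∉ab ∘ here)
  ... | inj₁ (refl , σa≡b′) = cast (λ p → FreshL p S) (sym σa≡b′) b′-fresh
  ... | inj₂ (_    , σa≡a)  = cast (λ p → FreshL p S) (sym σa≡a) a-fresh
  σa≢b : σ a ≢ b
  σa≢b with transpose-cases b b′ a (b′∉ab ∘ here)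
  ... | inj₁ (refl , σa≡b′) = b′∉ab ∘ there ∘ here ∘ trans (sym σa≡b′)
  ... | inj₂ (a≢b  , σa≡a)  = a≢b ∘ trans (sym σa≡a)

record Local (x : Var) (A : Formula) (a : Par) (s′ : Stage) (G H : LNS) (Pc Γ Qc Δ : List Formula) (T : LNS) : Set where
  field
    T₁ T₃   : LNS
    E Δ″    : List Formula
    target≈ : (T₁ ++ (Pc ++ E ++ Γ ⊢ Qc ++ Δ″) ∷ T₃) ≈L T
    premise : ∀ P Q → Transform x A a before s′ (G ++ (P ++ Γ ⊢ Q ++ Δ) ∷ H) (T₁ ++ (P ++ E ++ Γ ⊢ Q ++ Δ″) ∷ T₃)

local : ∀ {x A a s′} G H Pc Γ Qc Δ {T} → All (_≢ ∀′ x A) Qc →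
        Transform x A a before s′ (G ++ (Pc ++ Γ ⊢ Qc ++ Δ) ∷ H) T → Local x A a s′ G H Pc Γ Qc Δ T
local G H Pc Γ Qc Δ Qc≢∀xA r with split G r
... | splits {T₁ = T₁} r₁ (step {I = I} {T = T₃} (E , Γ′↭) st ins r₂) with side-steps Qc Qc≢∀xA st
...   | Δ″ , st″ , Δ′↭ = record
  { T₁ = T₁ ; T₃ = I ++ T₃ ; E = E ; Δ″ = Δ″
  ; target≈ = ≈L-at T₁ _ (↭-trans (↭.shifts Pc E {Γ}) (↭-sym Γ′↭)) (↭-sym Δ′↭)
  ; premise = λ P Q → r₁ ++ᵀ step (E , ↭.shifts P E {Γ}) (step-++ˡ Q st″) ins r₂
  }

case-perm : ∀ {S S′} → S ≈L S′ → TransformsDerivable S → TransformsDerivable S′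
case-perm S≈S′ ih x A a T r done fr = ih x A a T (transform-resp-≈ S≈S′ r) done (FreshL-resp-≈ S≈S′ fr)

case-id₁ : ∀ G H Γ Δ p ts → TransformsDerivable (G ++ (atom p ts ∷ Γ ⊢ atom p ts ∷ Δ) ∷ H)
case-id₁ G H Γ Δ p ts x A a T r done fr = perm target≈ (id₁ T₁ T₃ (E ++ Γ) Δ″ p ts)
  where open Local (local G H (atom p ts ∷ []) Γ (atom p ts ∷ []) Δ ((λ ()) ∷ []) r)

case-⊥l : ∀ G H Γ Δ → TransformsDerivable (G ++ (⊥′ ∷ Γ ⊢ Δ) ∷ H)
case-⊥l G H Γ Δ x A a T r done fr = perm target≈ (⊥l T₁ T₃ (E ++ Γ) Δ″)
  where open Local (local G H (⊥′ ∷ []) Γ [] Δ [] r)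

case-∧l : ∀ G H Γ Δ C D → TransformsDerivable (G ++ (C ∷ D ∷ Γ ⊢ Δ) ∷ H) →
          TransformsDerivable (G ++ (C ∧′ D ∷ Γ ⊢ Δ) ∷ H)
case-∧l G H Γ Δ C D ih x A a T r done fr =
  perm target≈ (∧l (ih x A a _ (premise (C ∷ D ∷ []) []) done (FreshL-local G (C ∧′ D ∷ []) [] parts id fr)))
  where
  open Local (local G H (C ∧′ D ∷ []) Γ [] Δ [] r)
  parts : FreshΓ a (C ∧′ D ∷ []) → FreshΓ a (C ∷ D ∷ [])
  parts (frCD ∷ []) = ++⁻ˡ (parsF C) frCD ∷ ++⁻ʳ (parsF C) frCD ∷ []

case-∨r : ∀ G H Γ Δ C D → TransformsDerivable (G ++ (Γ ⊢ C ∷ D ∷ Δ) ∷ H) →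
          TransformsDerivable (G ++ (Γ ⊢ C ∨′ D ∷ Δ) ∷ H)
case-∨r G H Γ Δ C D ih x A a T r done fr =
  perm target≈ (∨r (ih x A a _ (premise [] (C ∷ D ∷ [])) done (FreshL-local G [] (C ∨′ D ∷ []) id parts fr)))
  where
  open Local (local G H [] Γ (C ∨′ D ∷ []) Δ ((λ ()) ∷ []) r)
  parts : FreshΓ a (C ∨′ D ∷ []) → FreshΓ a (C ∷ D ∷ [])
  parts (frCD ∷ []) = ++⁻ˡ (parsF C) frCD ∷ ++⁻ʳ (parsF C) frCD ∷ []

case-∧r : ∀ G H Γ Δ C D → TransformsDerivable (G ++ (Γ ⊢ C ∷ Δ) ∷ H) → TransformsDerivable (G ++ (Γ ⊢ D ∷ Δ) ∷ H) →
          TransformsDerivable (G ++ (Γ ⊢ C ∧′ D ∷ Δ) ∷ H)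
case-∧r G H Γ Δ C D ih₁ ih₂ x A a T r done fr =
  perm target≈ (∧r (ih₁ x A a _ (premise [] (C ∷ [])) done (FreshL-local G [] (C ∧′ D ∷ []) id left fr))
                   (ih₂ x A a _ (premise [] (D ∷ [])) done (FreshL-local G [] (C ∧′ D ∷ []) id right fr)))
  where
  open Local (local G H [] Γ (C ∧′ D ∷ []) Δ ((λ ()) ∷ []) r)
  left : FreshΓ a (C ∧′ D ∷ []) → FreshΓ a (C ∷ [])
  left (frCD ∷ []) = ++⁻ˡ (parsF C) frCD ∷ []
  right : FreshΓ a (C ∧′ D ∷ []) → FreshΓ a (D ∷ [])
  right (frCD ∷ []) = ++⁻ʳ (parsF C) frCD ∷ []

case-∨l : ∀ G H Γ Δ C D → TransformsDerivable (G ++ (C ∷ Γ ⊢ Δ) ∷ H) → TransformsDerivable (G ++ (D ∷ Γ ⊢ Δ) ∷ H) →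
          TransformsDerivable (G ++ (C ∨′ D ∷ Γ ⊢ Δ) ∷ H)
case-∨l G H Γ Δ C D ih₁ ih₂ x A a T r done fr =
  perm target≈ (∨l (ih₁ x A a _ (premise (C ∷ []) []) done (FreshL-local G (C ∨′ D ∷ []) [] left id fr))
                   (ih₂ x A a _ (premise (D ∷ []) []) done (FreshL-local G (C ∨′ D ∷ []) [] right id fr)))
  where
  open Local (local G H (C ∨′ D ∷ []) Γ [] Δ [] r)
  left : FreshΓ a (C ∨′ D ∷ []) → FreshΓ a (C ∷ [])
  left (frCD ∷ []) = ++⁻ˡ (parsF C) frCD ∷ []
  right : FreshΓ a (C ∨′ D ∷ []) → FreshΓ a (D ∷ [])
  right (frCD ∷ []) = ++⁻ʳ (parsF C) frCD ∷ []

case-⊃l : ∀ G H Γ Δ C D → TransformsDerivable (G ++ (D ∷ Γ ⊢ Δ) ∷ H) →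
          TransformsDerivable (G ++ ((C ⊃ D) ∷ Γ ⊢ C ∷ Δ) ∷ H) → TransformsDerivable (G ++ ((C ⊃ D) ∷ Γ ⊢ Δ) ∷ H)
case-⊃l G H Γ Δ C D ih₁ ih₂ x A a T r done fr =
  perm target≈ (⊃l (ih₁ x A a _ (premise (D ∷ []) []) done (FreshL-local G ((C ⊃ D) ∷ []) [] right id fr))
                   (ih₂ x A a _ (premise ((C ⊃ D) ∷ []) (C ∷ [])) done fr₂))
  where
  open Local (local G H ((C ⊃ D) ∷ []) Γ [] Δ [] r)
  right : FreshΓ a ((C ⊃ D) ∷ []) → FreshΓ a (D ∷ [])
  right (frCD ∷ []) = ++⁻ʳ (parsF C) frCD ∷ []
  fr₂ : FreshL a (G ++ ((C ⊃ D) ∷ Γ ⊢ C ∷ Δ) ∷ H)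
  fr₂ = FreshL-update G (_ ∷ []) (λ { ((frCD ∷ frΓ , frΔ) ∷ []) → (frCD ∷ frΓ , ++⁻ˡ (parsF C) frCD ∷ frΔ) ∷ [] }) fr

case-∀l : ∀ G H Γ Δ y B c → TransformsDerivable (G ++ (B [ c / y ] ∷ ∀′ y B ∷ Γ ⊢ Δ) ∷ H) →
          TransformsDerivable (G ++ (∀′ y B ∷ Γ ⊢ Δ) ∷ H)
case-∀l G H Γ Δ y B c ih = avoiding (c ∷ []) λ x A a T r done fr a∉c →
  let open Local (local G H (∀′ y B ∷ []) Γ [] Δ [] r) in
  perm target≈ (∀l c (ih x A a _ (premise (B [ c / y ] ∷ ∀′ y B ∷ []) []) done
    (FreshL-local G (∀′ y B ∷ []) [] (λ { (frB ∷ []) → FreshF-subst y B (a∉c ∘ here) frB ∷ frB ∷ [] }) id fr)))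

case-∃r : ∀ G H Γ Δ y B c → TransformsDerivable (G ++ (Γ ⊢ B [ c / y ] ∷ ∃′ y B ∷ Δ) ∷ H) →
          TransformsDerivable (G ++ (Γ ⊢ ∃′ y B ∷ Δ) ∷ H)
case-∃r G H Γ Δ y B c ih = avoiding (c ∷ []) λ x A a T r done fr a∉c →
  let open Local (local G H [] Γ (∃′ y B ∷ []) Δ ((λ ()) ∷ []) r) in
  perm target≈ (∃r c (ih x A a _ (premise [] (B [ c / y ] ∷ ∃′ y B ∷ [])) done
    (FreshL-local G [] (∃′ y B ∷ []) id (λ { (frB ∷ []) → FreshF-subst y B (a∉c ∘ here) frB ∷ frB ∷ [] }) fr)))

case-∃l : ∀ G H Γ Δ y B b → Fresh b (G ++ (∃′ y B ∷ Γ ⊢ Δ) ∷ H) → TransformsDerivable (G ++ (B [ b / y ] ∷ Γ ⊢ Δ) ∷ H) →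
          TransformsDerivable (G ++ (∃′ y B ∷ Γ ⊢ Δ) ∷ H)
case-∃l G H Γ Δ y B b b-fresh ih = avoiding-eigenvariable b b-fresh λ x A a T r done fr b∉T a≢b →
  let open Local (local G H (∃′ y B ∷ []) Γ [] Δ [] r) in
  perm target≈ (∃l b (Fresh-resp-≈ target≈ b∉T) (ih x A a _ (premise (B [ b / y ] ∷ []) []) done
    (FreshL-local G (∃′ y B ∷ []) [] (λ { (frB ∷ []) → FreshF-subst y B a≢b frB ∷ [] }) id fr)))

case-id₂ : ∀ G H F Γ₁ Δ₁ Γ₂ Δ₂ p ts → TransformsDerivable (G ++ (atom p ts ∷ Γ₁ ⊢ Δ₁) ∷ H ++ (Γ₂ ⊢ atom p ts ∷ Δ₂) ∷ F)
case-id₂ G H F Γ₁ Δ₁ Γ₂ Δ₂ p ts x A a T r done fr with split G r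
... | splits {T₁ = T₁} r₁ (step {I = I₁} (E₁ , Γ₁′↭) _ _ r₂) with split H r₂
...   | splits {T₁ = T₂} _ (step {I = I₂} {T = T₃} _ st₂ _ _) with side-step (λ ()) st₂
...     | Δ₂″ , _ , Δ₂′↭ =
  cast (λ X → LNIF (T₁ ++ _ ∷ X)) (++-assoc I₁ T₂ _)
    (perm (Pointwise.++⁺ (≈L-refl T₁) ((↭-trans (↭.shifts (atom p ts ∷ []) E₁ {Γ₁}) (↭-sym Γ₁′↭) , ↭-refl) ∷
                                        ≈L-at (I₁ ++ T₂) (I₂ ++ T₃) ↭-refl (↭-sym Δ₂′↭)))
      (id₂ T₁ (I₁ ++ T₂) (I₂ ++ T₃) (E₁ ++ Γ₁) _ _ Δ₂″ p ts))

-- A component inserted right after the active one lies between the two components of ⊃r₂, ∀r₂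
-- or lift (for ⊃r₁ and ∀r₁, between the active and the new one): the rule is then applied twice,
-- once across the inserted component and once from it.
case-⊃r₁ : ∀ G Γ Δ C D → TransformsDerivable (G ++ (Γ ⊢ Δ) ∷ (C ∷ [] ⊢ D ∷ []) ∷ []) →
           TransformsDerivable (G ++ (Γ ⊢ (C ⊃ D) ∷ Δ) ∷ [])
case-⊃r₁ G Γ Δ C D ih x A a T r done fr with split G r
... | splits {T₁ = T₁} r₁ (step (E , Γ′↭) st ins []) with side-step (λ ()) st | ins
...   | Δ″ , st″ , Δ′↭ | none =
  perm-at T₁ [] (↭-sym Γ′↭) (↭-sym Δ′↭)
    (⊃r₁ (ih x A a _ (r₁ ++ᵀ step (E , ↭-refl) st″ none (untouched [])) done (FreshL-⊃ G fr)))
...   | Δ″ , st″ , Δ′↭ | new E′ =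
  perm-at T₁ _ (↭-sym Γ′↭) (↭-sym Δ′↭)
    (⊃r₂ (ih x A a _ (r₁ ++ᵀ step (E , ↭-refl) st″ none (insert-after E′ [])) done (FreshL-⊃ G fr))
         (ungroup T₁ _ _ (⊃r₁ (regroup LNIF T₁ _ _
           (ih x A a _ (r₁ ++ᵀ step (E , ↭-refl) st″ (new E′) (untouched [])) done (FreshL-⊃ G fr))))))

case-⊃r₂ : ∀ G H Γ₁ Δ₁ Γ₂ Δ₂ C D → TransformsDerivable (G ++ (Γ₁ ⊢ Δ₁) ∷ (C ∷ [] ⊢ D ∷ []) ∷ (Γ₂ ⊢ Δ₂) ∷ H) →
           TransformsDerivable (G ++ (Γ₁ ⊢ Δ₁) ∷ (Γ₂ ⊢ (C ⊃ D) ∷ Δ₂) ∷ H) →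
           TransformsDerivable (G ++ (Γ₁ ⊢ (C ⊃ D) ∷ Δ₁) ∷ (Γ₂ ⊢ Δ₂) ∷ H)
case-⊃r₂ G H Γ₁ Δ₁ Γ₂ Δ₂ C D ih₁ ih₂ x A a T r done fr with split G r
... | splits {T₁ = T₁} r₁ (step (E₁ , Γ₁′↭) st₁ ins₁ rest@(step _ _ _ _)) with side-step (λ ()) st₁ | ins₁
...   | Δ₁″ , st₁″ , Δ₁′↭ | none =
  perm-at T₁ _ (↭-sym Γ₁′↭) (↭-sym Δ₁′↭)
    (⊃r₂ (ih₁ x A a _ (r₁ ++ᵀ step (E₁ , ↭-refl) st₁″ none (untouched rest)) done (FreshL-⊃ G fr))
         (ih₂ x A a _ (r₁ ++ᵀ step (E₁ , ↭-refl) st₁″ none (prepend-succedent ((C ⊃ D) ∷ []) rest)) done (FreshL-move G fr)))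
...   | Δ₁″ , st₁″ , Δ₁′↭ | new E′ =
  perm-at T₁ _ (↭-sym Γ₁′↭) (↭-sym Δ₁′↭)
    (⊃r₂ (ih₁ x A a _ (r₁ ++ᵀ step (E₁ , ↭-refl) st₁″ none (insert-after E′ rest)) done (FreshL-⊃ G fr))
         (ungroup T₁ _ _ (⊃r₂
           (regroup LNIF T₁ _ _
             (ih₁ x A a _ (r₁ ++ᵀ step (E₁ , ↭-refl) st₁″ (new E′) (untouched rest)) done (FreshL-⊃ G fr)))
           (regroup LNIF T₁ _ _
             (ih₂ x A a _ (r₁ ++ᵀ step (E₁ , ↭-refl) st₁″ (new E′) (prepend-succedent ((C ⊃ D) ∷ []) rest))
                  done (FreshL-move G fr))))))

case-lift : ∀ G H Γ₁ Δ₁ Γ₂ Δ₂ C → TransformsDerivable (G ++ (C ∷ Γ₁ ⊢ Δ₁) ∷ (C ∷ Γ₂ ⊢ Δ₂) ∷ H) →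
            TransformsDerivable (G ++ (C ∷ Γ₁ ⊢ Δ₁) ∷ (Γ₂ ⊢ Δ₂) ∷ H)
case-lift G H Γ₁ Δ₁ Γ₂ Δ₂ C ih x A a T r done fr with split G r
... | splits {T₁ = T₁} r₁ (step (E₁ , Γ₁′↭) st₁ ins₁ rest@(step _ _ _ _)) with ins₁
...   | none =
  perm-at T₁ _ (↭-trans (↭.shifts (C ∷ []) E₁) (↭-sym Γ₁′↭)) ↭-refl
    (lift (ih x A a _ (r₁ ++ᵀ step (E₁ , ↭.shifts (C ∷ []) E₁) st₁ none (prepend-antecedent C rest))
              done (FreshL-lift G fr)))
...   | new E′ =
  perm-at T₁ _ (↭-trans (↭.shifts (C ∷ []) E₁) (↭-sym Γ₁′↭)) ↭-refl
    (lift (ungroup T₁ _ _ (lift (regroup LNIF T₁ _ _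
      (ih x A a _ (r₁ ++ᵀ step (E₁ , ↭.shifts (C ∷ []) E₁) st₁ (new (C ∷ E′)) (prepend-antecedent C rest))
           done (FreshL-lift G fr))))))

-- a and b are fresh for everything outside the weakenings, so transposing them fixes the premise
-- context and turns its component ⊢ A[b/x] into one with A[a/x].
principal-case :
  ∀ G H Γ Δ x A a b → FreshL a (G ++ (Γ ⊢ ∀′ x A ∷ Δ) ∷ H) → FreshL b (G ++ (Γ ⊢ ∀′ x A ∷ Δ) ∷ H) →
  TransformsDerivable (G ++ (Γ ⊢ Δ) ∷ ([] ⊢ A [ b / x ] ∷ []) ∷ H) →
  ∀ {s′ T₁ T₃ Γ′ Δ′ E′} → Transform x A a before before G T₁ → Γ ≼ Γ′ → Δ ↭ Δ′ → Transform x A a settled s′ H T₃ →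
  LNIF (T₁ ++ (Γ′ ⊢ Δ′) ∷ (E′ ⊢ A [ a / x ] ∷ []) ∷ T₃)
principal-case G H Γ Δ x A a b a-fresh b-fresh ih {T₁ = T₁} {T₃} {Γ′} {Δ′} {E′} r₁ (E , Γ′↭) Δ↭ r₃
  with settled-final r₃ | ++⁻ G a-fresh | ++⁻ G b-fresh | fresh-for (parsL (G ++ (Γ ⊢ Δ) ∷ ([] ⊢ A [ b / x ] ∷ []) ∷ H))
... | refl | aG , (aΓ , aA ∷ aΔ) ∷ aH | bG , (bΓ , bA ∷ bΔ) ∷ bH | a* , a*∉ =
  untranspose a b (cast LNIF target≡ (ih x A a* _ transform (λ ()) (Fresh⇒FreshL _ a*∉)))
  where
  σ : Par → Par
  σ = transpose a b
  Γ≼σΓ′ : Γ ≼ map (renF σ) Γ′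
  Γ≼σΓ′ = map (renF σ) E , cast (λ Γ₀ → map (renF σ) Γ′ ↭ map (renF σ) E ++ Γ₀) (renΓ-transpose-fresh aΓ bΓ)
                             (↭-trans (↭.map⁺ (renF σ) Γ′↭) (↭-reflexive (map-++ (renF σ) E Γ)))
  Δ↭σΔ′ : Δ ↭ map (renF σ) Δ′
  Δ↭σΔ′ = cast (_↭ map (renF σ) Δ′) (renΓ-transpose-fresh aΔ bΔ) (↭.map⁺ (renF σ) Δ↭)
  σT : LNS
  σT = renL σ T₁ ++ (map (renF σ) Γ′ ⊢ map (renF σ) Δ′) ∷ (map (renF σ) E′ ⊢ A [ b / x ] ∷ []) ∷ renL σ T₃
  transform : Transform x A a* before before (G ++ (Γ ⊢ Δ) ∷ ([] ⊢ A [ b / x ] ∷ []) ∷ H) σT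
  transform =
    weakening (λ ()) (transpose-transform aG bG r₁) ++ᵀ
    step Γ≼σΓ′ (keep Δ↭σΔ′) none
      (step (map (renF σ) E′ , ↭-reflexive (sym (++-identityʳ _))) (keep ↭-refl) none
        (weakening (λ ()) (transpose-transform aH bH r₃)))
  σA[a/x]≡A[b/x] : renF σ (A [ a / x ]) ≡ A [ b / x ]
  σA[a/x]≡A[b/x] = trans (renF-subst σ x a A) (cong₂ (λ B p → B [ p / x ]) (renF-transpose-fresh A aA bA) (transpose-ˡ a b))
  target≡ : σT ≡ renL σ (T₁ ++ (Γ′ ⊢ Δ′) ∷ (E′ ⊢ A [ a / x ] ∷ []) ∷ T₃)
  target≡ = begin
    σT
      ≡⟨ cong (λ B → renL σ T₁ ++ renC σ (Γ′ ⊢ Δ′) ∷ (map (renF σ) E′ ⊢ B ∷ []) ∷ renL σ T₃) σA[a/x]≡A[b/x] ⟨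
    renL σ T₁ ++ renL σ ((Γ′ ⊢ Δ′) ∷ (E′ ⊢ A [ a / x ] ∷ []) ∷ T₃)
      ≡⟨ map-++ (renC σ) T₁ _ ⟨
    renL σ (T₁ ++ (Γ′ ⊢ Δ′) ∷ (E′ ⊢ A [ a / x ] ∷ []) ∷ T₃) ∎
    where open ≡-Reasoning

-- ∀xA is still owed after its principal component, and in the second premise of ∀r₂ it sits in
-- the next component: take it from there instead.
owed-principal-case :
  ∀ G H Γ₁ Δ₁ Γ₂ Δ₂ x A a {s′ T₁ Γ₁′ Δ₁′ T₂} →
  TransformsDerivable (G ++ (Γ₁ ⊢ Δ₁) ∷ (Γ₂ ⊢ ∀′ x A ∷ Δ₂) ∷ H) → s′ ≢ owing →
  FreshL a (G ++ (Γ₁ ⊢ Δ₁) ∷ (Γ₂ ⊢ ∀′ x A ∷ Δ₂) ∷ H) →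
  Transform x A a before before G T₁ → Γ₁ ≼ Γ₁′ → Δ₁ ↭ Δ₁′ → Transform x A a owing s′ ((Γ₂ ⊢ Δ₂) ∷ H) T₂ →
  LNIF (T₁ ++ (Γ₁′ ⊢ Δ₁′) ∷ T₂)
owed-principal-case G H Γ₁ Δ₁ Γ₂ Δ₂ x A a ih done fr r₁ w₁ Δ₁↭ (step w₂ (keep Δ₂↭) ins₂ r₃) =
  ih x A a _ (r₁ ++ᵀ step w₁ (keep Δ₁↭) none (step w₂ (take (prep _ Δ₂↭)) ins₂ r₃)) done fr
owed-principal-case G H Γ₁ Δ₁ Γ₂ Δ₂ x A a ih done fr r₁ w₁ Δ₁↭ (step w₂ (give Δ₂↭) none r₃) with settled-final r₃
... | refl = ih x A a _ (r₁ ++ᵀ step w₁ (keep Δ₁↭) none (step w₂ (keep Δ₂↭) none (weakening (λ ()) r₃))) (λ ()) fr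

case-∀r₁ : ∀ G Γ Δ y B b → Fresh b (G ++ (Γ ⊢ ∀′ y B ∷ Δ) ∷ []) →
           TransformsDerivable (G ++ (Γ ⊢ Δ) ∷ ([] ⊢ B [ b / y ] ∷ []) ∷ []) →
           TransformsDerivable (G ++ (Γ ⊢ ∀′ y B ∷ Δ) ∷ [])
case-∀r₁ G Γ Δ y B b b-fresh ih = avoiding-eigenvariable b b-fresh go
  where
  go : ∀ x A a {s′} T → Transform x A a before s′ (G ++ (Γ ⊢ ∀′ y B ∷ Δ) ∷ []) T → s′ ≢ owing →
       FreshL a (G ++ (Γ ⊢ ∀′ y B ∷ Δ) ∷ []) → b ∉ parsL T → a ≢ b → LNIF T
  go x A a T r done fr b∉T a≢b with split G r
  ... | splits {T₁ = T₁} r₁ (step (E , Γ′↭) st ins []) with view-step st | ins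
  ...   | side Δ″ st″ Δ′↭ | none =
    perm target≈ (∀r₁ b (Fresh-resp-≈ target≈ b∉T)
      (ih x A a _ (r₁ ++ᵀ step (E , ↭-refl) st″ none (untouched [])) done (FreshL-∀ G a≢b fr)))
    where target≈ = ≈L-at T₁ [] (↭-sym Γ′↭) (↭-sym Δ′↭)
  ...   | side Δ″ st″ Δ′↭ | new E′ =
    perm target≈ (∀r₂ b b∉conclusion
      (ih x A a _ (r₁ ++ᵀ step (E , ↭-refl) st″ none (insert-after E′ [])) done (FreshL-∀ G a≢b fr))
      (ungroup T₁ _ _ (∀r₁ b (regroup (Fresh b) T₁ _ _ (Fresh-move T₁ b∉conclusion)) (regroup LNIF T₁ _ _
        (ih x A a _ (r₁ ++ᵀ step (E , ↭-refl) st″ (new E′) (untouched [])) done (FreshL-∀ G a≢b fr))))))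
    where
    target≈      = ≈L-at T₁ _ (↭-sym Γ′↭) (↭-sym Δ′↭)
    b∉conclusion = Fresh-resp-≈ target≈ b∉T
  ...   | principal refl refl refl _ | none = ⊥-elim (done refl)
  ...   | principal refl refl refl Δ↭ | new E′ =
    principal-case G [] Γ Δ y B a b fr (Fresh⇒FreshL _ b-fresh) ih r₁ (E , Γ′↭) Δ↭ []

case-∀r₂ : ∀ G H Γ₁ Δ₁ Γ₂ Δ₂ y B b → Fresh b (G ++ (Γ₁ ⊢ ∀′ y B ∷ Δ₁) ∷ (Γ₂ ⊢ Δ₂) ∷ H) →
           TransformsDerivable (G ++ (Γ₁ ⊢ Δ₁) ∷ ([] ⊢ B [ b / y ] ∷ []) ∷ (Γ₂ ⊢ Δ₂) ∷ H) →
           TransformsDerivable (G ++ (Γ₁ ⊢ Δ₁) ∷ (Γ₂ ⊢ ∀′ y B ∷ Δ₂) ∷ H) →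
           TransformsDerivable (G ++ (Γ₁ ⊢ ∀′ y B ∷ Δ₁) ∷ (Γ₂ ⊢ Δ₂) ∷ H)
case-∀r₂ G H Γ₁ Δ₁ Γ₂ Δ₂ y B b b-fresh ih₁ ih₂ = avoiding-eigenvariable b b-fresh go
  where
  go : ∀ x A a {s′} T → Transform x A a before s′ (G ++ (Γ₁ ⊢ ∀′ y B ∷ Δ₁) ∷ (Γ₂ ⊢ Δ₂) ∷ H) T → s′ ≢ owing →
       FreshL a (G ++ (Γ₁ ⊢ ∀′ y B ∷ Δ₁) ∷ (Γ₂ ⊢ Δ₂) ∷ H) → b ∉ parsL T → a ≢ b → LNIF T
  go x A a T r done fr b∉T a≢b with split G r
  ... | splits {T₁ = T₁} r₁ (step (E₁ , Γ₁′↭) st₁ ins₁ rest@(step _ _ _ _)) with view-step st₁ | ins₁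
  ...   | side Δ₁″ st₁″ Δ₁′↭ | none =
    perm target≈ (∀r₂ b (Fresh-resp-≈ target≈ b∉T)
      (ih₁ x A a _ (r₁ ++ᵀ step (E₁ , ↭-refl) st₁″ none (untouched rest)) done (FreshL-∀ G a≢b fr))
      (ih₂ x A a _ (r₁ ++ᵀ step (E₁ , ↭-refl) st₁″ none (prepend-succedent (∀′ y B ∷ []) rest)) done (FreshL-move G fr)))
    where target≈ = ≈L-at T₁ _ (↭-sym Γ₁′↭) (↭-sym Δ₁′↭)
  ...   | side Δ₁″ st₁″ Δ₁′↭ | new E′ =
    perm target≈ (∀r₂ b b∉conclusion
      (ih₁ x A a _ (r₁ ++ᵀ step (E₁ , ↭-refl) st₁″ none (insert-after E′ rest)) done (FreshL-∀ G a≢b fr))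
      (ungroup T₁ _ _ (∀r₂ b (regroup (Fresh b) T₁ _ _ (Fresh-move T₁ b∉conclusion))
        (regroup LNIF T₁ _ _
          (ih₁ x A a _ (r₁ ++ᵀ step (E₁ , ↭-refl) st₁″ (new E′) (untouched rest)) done (FreshL-∀ G a≢b fr)))
        (regroup LNIF T₁ _ _
          (ih₂ x A a _ (r₁ ++ᵀ step (E₁ , ↭-refl) st₁″ (new E′) (prepend-succedent (∀′ y B ∷ []) rest))
               done (FreshL-move G fr))))))
    where
    target≈      = ≈L-at T₁ _ (↭-sym Γ₁′↭) (↭-sym Δ₁′↭)
    b∉conclusion = Fresh-resp-≈ target≈ b∉T
  ...   | principal refl refl refl Δ₁↭ | none =
    owed-principal-case G H Γ₁ Δ₁ Γ₂ Δ₂ y B a ih₂ done (FreshL-move G fr) r₁ (E₁ , Γ₁′↭) Δ₁↭ rest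
  ...   | principal refl refl refl Δ₁↭ | new E′ =
    principal-case G ((Γ₂ ⊢ Δ₂) ∷ H) Γ₁ Δ₁ y B a b fr (Fresh⇒FreshL _ b-fresh) ih₁ r₁ (E₁ , Γ₁′↭) Δ₁↭ rest

transforms-derivable : ∀ {S} → LNIF S → TransformsDerivable S
transforms-derivable (perm S≈S′ d)               = case-perm S≈S′ (transforms-derivable d)
transforms-derivable (id₁ G H Γ Δ p ts)           = case-id₁ G H Γ Δ p ts
transforms-derivable (id₂ G H F Γ₁ Δ₁ Γ₂ Δ₂ p ts) = case-id₂ G H F Γ₁ Δ₁ Γ₂ Δ₂ p ts
transforms-derivable (⊥l G H Γ Δ)                 = case-⊥l G H Γ Δ
transforms-derivable (∧l {G} {H} {Γ} {Δ} {C} {D} d) = case-∧l G H Γ Δ C D (transforms-derivable d)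
transforms-derivable (∨r {G} {H} {Γ} {Δ} {C} {D} d) = case-∨r G H Γ Δ C D (transforms-derivable d)
transforms-derivable (∧r {G} {H} {Γ} {Δ} {C} {D} d e) =
  case-∧r G H Γ Δ C D (transforms-derivable d) (transforms-derivable e)
transforms-derivable (∨l {G} {H} {Γ} {Δ} {C} {D} d e) =
  case-∨l G H Γ Δ C D (transforms-derivable d) (transforms-derivable e)
transforms-derivable (⊃r₁ {G} {Γ} {Δ} {C} {D} d) = case-⊃r₁ G Γ Δ C D (transforms-derivable d)
transforms-derivable (⊃l {G} {H} {Γ} {Δ} {C} {D} d e) =
  case-⊃l G H Γ Δ C D (transforms-derivable d) (transforms-derivable e)
transforms-derivable (lift {G} {H} {Γ₁} {Δ₁} {Γ₂} {Δ₂} {C} d) =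
  case-lift G H Γ₁ Δ₁ Γ₂ Δ₂ C (transforms-derivable d)
transforms-derivable (∀l {G} {H} {Γ} {Δ} {y} {B} c d) = case-∀l G H Γ Δ y B c (transforms-derivable d)
transforms-derivable (∀r₁ {G} {Γ} {Δ} {y} {B} b b-fresh d) =
  case-∀r₁ G Γ Δ y B b b-fresh (transforms-derivable d)
transforms-derivable (∃l {G} {H} {Γ} {Δ} {y} {B} b b-fresh d) =
  case-∃l G H Γ Δ y B b b-fresh (transforms-derivable d)
transforms-derivable (∃r {G} {H} {Γ} {Δ} {y} {B} c d) = case-∃r G H Γ Δ y B c (transforms-derivable d)
transforms-derivable (⊃r₂ {G} {H} {Γ₁} {Δ₁} {Γ₂} {Δ₂} {C} {D} d e) =
  case-⊃r₂ G H Γ₁ Δ₁ Γ₂ Δ₂ C D (transforms-derivable d) (transforms-derivable e)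
transforms-derivable (∀r₂ {G} {H} {Γ₁} {Δ₁} {Γ₂} {Δ₂} {y} {B} b b-fresh d e) =
  case-∀r₂ G H Γ₁ Δ₁ Γ₂ Δ₂ y B b b-fresh (transforms-derivable d) (transforms-derivable e)

lemma11 : ∀ (G H : LNS) (Γ₁ Δ₁ Γ₂ Δ₂ : List Formula) (x : Var) (A : Formula) (a : Par) →
          LNIF (G ++ ((Γ₁ ⊢ ∀′ x A ∷ Δ₁) ∷ (Γ₂ ⊢ Δ₂) ∷ H)) →
          Fresh a (G ++ ((Γ₁ ⊢ ∀′ x A ∷ Δ₁) ∷ (Γ₂ ⊢ Δ₂) ∷ H)) →
          LNIF (G ++ ((Γ₁ ⊢ Δ₁) ∷ ([] ⊢ A [ a / x ] ∷ []) ∷ (Γ₂ ⊢ Δ₂) ∷ H))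
            × LNIF (G ++ ((Γ₁ ⊢ Δ₁) ∷ (Γ₂ ⊢ ∀′ x A ∷ Δ₂) ∷ H))
lemma11 G H Γ₁ Δ₁ Γ₂ Δ₂ x A a der a-fresh =
  invert (identity G ++ᵀ step ([] , ↭-refl) (take ↭-refl) (new []) (identity ((Γ₂ ⊢ Δ₂) ∷ H))) ,
  invert (identity G ++ᵀ step ([] , ↭-refl) (take ↭-refl) none (step ([] , ↭-refl) (give ↭-refl) none (identity H)))
  where
  invert : ∀ {T} → Transform x A a before settled (G ++ (Γ₁ ⊢ ∀′ x A ∷ Δ₁) ∷ (Γ₂ ⊢ Δ₂) ∷ H) T → LNIF T
  invert r = transforms-derivable der x A a _ r (λ ()) (Fresh⇒FreshL _ a-fresh)
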